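{- Let $A\subseteq[n]$ and let $\mathcal C\subseteq\mathbb R^n$ be a cone generated by $p$ extremal rays $\{r_1,\dots,r_p\}\subseteq R_A$. Then every triangulation of $\mathcal C$ (into simplicial cones generated by subsets of $\{r_1,\dots,r_p\}$) is unimodular.
   Context: $e_i$ denotes the $i$-th standard unit vector of $\mathbb R^n$. For $A\subseteq[n]$ the elementary set of $A$ is $R_A=\{e_i-e_j,\ e_i,\ -e_j : i\in[n],\ j\in A\}$. A simplicial cone is unimodular if its generators form a basis of the lattice $\mathbb Z^n\cap\mathrm{lin}(\text{cone})$ (equivalently, its fundamental parallelepiped contains only the lattice point $0$); a triangulation of a cone is unimodular if each of its simplicial cones is unimodular.
   Formalization: The cone $\mathcal C$ and the simplicial cones of each triangulation are taken as sets of points with rational coordinates, formed with rational coefficients, rather than as subsets of ℝ^n. -}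

module Defs where

open import Data.Nat using (ℕ; zero; suc)
open import Data.Fin using (Fin; zero; suc; _≟_)
open import Relation.Nullary.Decidable using (does)
open import Data.Bool using (if_then_else_)
open import Data.Sum using (_⊎_)
open import Data.Fin.Subset using (Subset; _∈_; _∉_; ⊤; _∩_)
open import Data.Integer using (ℤ)
import Data.Integer as ℤ
open import Data.Rational using (ℚ; 0ℚ; _+_; _*_; _≤_; -_; _/_)
open import Data.Product using (Σ; ∃; _×_)
open import Relation.Binary.PropositionalEquality using (_≡_)
open import Relation.Nullary using (¬_)

Vecℚ : ℕ → Set
Vecℚ n = Fin n → ℚ

Vecℤ : ℕ → Set
Vecℤ n = Fin n → ℤ

toℚ : ℤ → ℚ
toℚ z = z / 1

toℚᵛ : ∀ {n} → Vecℤ n → Vecℚ n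
toℚᵛ v i = toℚ (v i)

_≈ᵛ_ : ∀ {n} → Vecℚ n → Vecℚ n → Set
x ≈ᵛ y = ∀ i → x i ≡ y i

_≈ℤ_ : ∀ {n} → Vecℤ n → Vecℤ n → Set
x ≈ℤ y = ∀ i → x i ≡ y i

0ᵛ : ∀ {n} → Vecℚ n
0ᵛ _ = 0ℚ

_+ᵛ_ : ∀ {n} → Vecℚ n → Vecℚ n → Vecℚ n
(x +ᵛ y) i = x i + y i

_·ᵛ_ : ∀ {n} → ℚ → Vecℚ n → Vecℚ n
(c ·ᵛ x) i = c * x i

sumFin : ∀ {p} → (Fin p → ℚ) → ℚ
sumFin {zero} f = 0ℚ
sumFin {suc p} f = f zero + sumFin (λ k → f (suc k))

comb : ∀ {n p} → (Fin p → ℚ) → (Fin p → Vecℤ n) → Vecℚ n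
comb λ' r i = sumFin (λ k → λ' k * toℚ (r k i))

SupportedOn : ∀ {p} {A : Set} → A → (Fin p → A) → Subset p → Set
SupportedOn z λ' σ = ∀ k → k ∉ σ → λ' k ≡ z

Region : ℕ → Set₁
Region n = Vecℚ n → Set

Cone : ∀ {n p} → (Fin p → Vecℤ n) → Subset p → Region n
Cone r σ x = Σ (_ → ℚ) λ λ' →
  (∀ k → 0ℚ ≤ λ' k) × SupportedOn 0ℚ λ' σ × (x ≈ᵛ comb λ' r)

Ray : ∀ {n} → Vecℚ n → Region n
Ray v x = Σ ℚ λ c → (0ℚ ≤ c) × (x ≈ᵛ (c ·ᵛ v))

_⊆ᴿ_ : ∀ {n} → Region n → Region n → Set
K ⊆ᴿ L = ∀ x → K x → L x

_∩ᴿ_ : ∀ {n} → Region n → Region n → Region n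
(K ∩ᴿ L) x = K x × L x

IsFace : ∀ {n} → Region n → Region n → Set
IsFace K F = (F ⊆ᴿ K) × (∀ x y → K x → K y → F (x +ᵛ y) → F x × F y)

LinIndep : ∀ {n p} → (Fin p → Vecℤ n) → Subset p → Set
LinIndep r σ = ∀ (λ' : _ → ℚ) → SupportedOn 0ℚ λ' σ → comb λ' r ≈ᵛ 0ᵛ → ∀ k → λ' k ≡ 0ℚ

-- the simplicial cone generated by {r_k : k ∈ σ} is unimodular: its generators
-- form a basis of the lattice ℤ^n ∩ lin{r_k : k ∈ σ}
IsUnimodular : ∀ {n p} → (Fin p → Vecℤ n) → Subset p → Set
IsUnimodular {n} r σ = LinIndep r σ ×
  (∀ (z : Vecℤ n) → ∀ (μ : _ → ℚ) → SupportedOn 0ℚ μ σ → toℚᵛ z ≈ᵛ comb μ r →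
     Σ (_ → ℤ) λ ν → SupportedOn (ℤ.+ 0) ν σ × (toℚᵛ z ≈ᵛ comb (λ k → toℚ (ν k)) r))

e : ∀ {n} → Fin n → Vecℤ n
e i j = if does (i ≟ j) then ℤ.+ 1 else ℤ.+ 0

InElementarySet : ∀ {n} → Subset n → Vecℤ n → Set
InElementarySet {n} A v =
    (Σ (Fin n) λ i → Σ (Fin n) λ j → j ∈ A × (v ≈ℤ (λ l → e i l ℤ.- e j l)))
  ⊎ (Σ (Fin n) λ i → v ≈ℤ e i)
  ⊎ (Σ (Fin n) λ j → j ∈ A × (v ≈ℤ (λ l → ℤ.- e j l)))

IsExtremalRay : ∀ {n p} → (Fin p → Vecℤ n) → Fin p → Set
IsExtremalRay r k = ¬ (toℚᵛ (r k) ≈ᵛ 0ᵛ) × IsFace (Cone r ⊤) (Ray (toℚᵛ (r k)))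

record IsTriangulation {n p m : ℕ} (r : Fin p → Vecℤ n) (σ : Fin m → Subset p) : Set where
  field
    simplicial : ∀ t → LinIndep r (σ t)
    inside     : ∀ t → Cone r (σ t) ⊆ᴿ Cone r ⊤
    covers     : ∀ x → Cone r ⊤ x → Σ (Fin m) λ t → Cone r (σ t) x
    faceToFace : ∀ t u → IsFace (Cone r (σ t)) (Cone r (σ t) ∩ᴿ Cone r (σ u))
                       × IsFace (Cone r (σ u)) (Cone r (σ t) ∩ᴿ Cone r (σ u))

{-# OPTIONS --safe #-}
-- The vectors e_i - e_j, e_i, -e_j have at most one entry 1 and one entry -1, like
-- the columns of a network matrix, and such matrices are totally unimodular: if
-- linearly independent columns v_k (k ∈ σ) have an integral combination
-- z = Σ μ_k v_k, then every μ_k is an integer. Induct on the number of rows. If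
-- some v_k₀ has c = v_k₀(0) = ±1, replace each v_k by v_k - v_k(0) c v_k₀; the new
-- vectors vanish in row 0, and on the remaining rows they are again network
-- columns, linearly independent for k ≠ k₀, with the integral combination
-- z - z(0) c v_k₀. So μ_k ∈ ℤ for k ≠ k₀ by induction, and then μ_k₀ ∈ ℤ from row 0.
-- If no column meets row 0, simply drop it.
module Submission where

open import Defs
open import Data.Bool using (true; false; if_then_else_)
open import Data.Fin using (Fin; zero; suc; _≟_)
open import Data.Fin.Properties using (any?)
open import Data.Fin.Subset using (Subset; _∈_; _∉_) renaming (_-_ to _∖_)
open import Data.Fin.Subset.Properties using (_∈?_; x∈p∧x≢y⇒x∈p-y; p─q⊆p)
open import Data.Integer as ℤ using (ℤ)
import Data.Integer.Properties as ℤP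
open import Data.Maybe using (Maybe; just; nothing)
open import Data.Nat using (ℕ)
open import Data.Nat.Coprimality using (1-coprimeTo) renaming (sym to coprime-sym)
open import Data.Product using (Σ; ∃; ∃₂; _×_; _,_; proj₁; proj₂)
open import Data.Rational using (ℚ; mkℚ; 0ℚ; 1ℚ; _+_; _*_; _-_; -_; _/_)
import Data.Rational.Properties as ℚP
open import Data.Rational.Solver using (module +-*-Solver)
open import Data.Sum using (_⊎_; inj₁; inj₂)
open import Data.Vec using (there) renaming (_∷_ to _∷ᵛ_)
open import Data.Vec.Functional using (head; tail)
open import Function using (_∘_)
open import Relation.Nullary using (Dec; yes; no; does; contradiction)
open import Relation.Nullary.Decidable using (_×-dec_; ¬?; decidable-stable)
open import Relation.Binary.PropositionalEquality

open +-*-Solver using (solve; _:=_; _:+_; _:*_; _:-_; :-_; con)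

toℚ≡mkℚ : ∀ z → toℚ z ≡ mkℚ z 0 (coprime-sym (1-coprimeTo _))
toℚ≡mkℚ z = ℚP.↥p/↧p≡p (mkℚ z 0 (coprime-sym (1-coprimeTo _)))

toℚ-+ : ∀ a b → toℚ (a ℤ.+ b) ≡ toℚ a + toℚ b
toℚ-+ a b rewrite toℚ≡mkℚ a | toℚ≡mkℚ b =
  sym (cong₂ (λ x y → (x ℤ.+ y) / 1) (ℤP.*-identityʳ a) (ℤP.*-identityʳ b))

toℚ-* : ∀ a b → toℚ (a ℤ.* b) ≡ toℚ a * toℚ b
toℚ-* a b rewrite toℚ≡mkℚ a | toℚ≡mkℚ b = refl

toℚ-neg : ∀ a → toℚ (ℤ.- a) ≡ - toℚ a
toℚ-neg a = begin
  toℚ (ℤ.- a)             ≡⟨ cong toℚ (ℤP.-1*i≡-i a) ⟨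
  toℚ (ℤ.- ℤ.+ 1 ℤ.* a)   ≡⟨ toℚ-* (ℤ.- ℤ.+ 1) a ⟩
  - 1ℚ * toℚ a            ≡⟨ -1*x≡-x (toℚ a) ⟩
  - toℚ a                 ∎
  where
  open ≡-Reasoning
  -1*x≡-x : ∀ x → - 1ℚ * x ≡ - x
  -1*x≡-x = solve 1 (λ x → :- con 1ℚ :* x := :- x) refl

toℚ-- : ∀ a b → toℚ (a ℤ.- b) ≡ toℚ a - toℚ b
toℚ-- a b = trans (toℚ-+ a (ℤ.- b)) (cong (toℚ a +_) (toℚ-neg b))

IsInt : ℚ → Set
IsInt q = ∃ λ z → q ≡ toℚ z

isInt-0 : IsInt 0ℚ
isInt-0 = ℤ.+ 0 , refl

isInt-1 : IsInt 1ℚ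
isInt-1 = ℤ.+ 1 , refl

isInt-+ : ∀ {x y} → IsInt x → IsInt y → IsInt (x + y)
isInt-+ (a , refl) (b , refl) = a ℤ.+ b , sym (toℚ-+ a b)

isInt-* : ∀ {x y} → IsInt x → IsInt y → IsInt (x * y)
isInt-* (a , refl) (b , refl) = a ℤ.* b , sym (toℚ-* a b)

isInt-- : ∀ {x y} → IsInt x → IsInt y → IsInt (x - y)
isInt-- (a , refl) (b , refl) = a ℤ.- b , sym (toℚ-- a b)

ℤ-coefficients : ∀ {p} {μ : Fin p → ℚ} {σ : Subset p} → SupportedOn 0ℚ μ σ →
  (∀ k → k ∈ σ → IsInt (μ k)) →
  Σ (Fin p → ℤ) λ ν → SupportedOn (ℤ.+ 0) ν σ × (∀ k → μ k ≡ toℚ (ν k))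
ℤ-coefficients {μ = μ} {σ} supp int =
  proj₁ ∘ choose , proj₂ ∘ proj₂ ∘ choose , proj₁ ∘ proj₂ ∘ choose
  where
  choose : ∀ k → Σ ℤ λ z → μ k ≡ toℚ z × (k ∉ σ → z ≡ ℤ.+ 0)
  choose k with k ∈? σ
  ... | yes k∈σ = let z , μ≡z = int k k∈σ in z , μ≡z , contradiction k∈σ
  ... | no k∉σ  = ℤ.+ 0 , supp k k∉σ , λ _ → refl

sumFin-cong : ∀ {p} {f g : Fin p → ℚ} → (∀ k → f k ≡ g k) → sumFin f ≡ sumFin g
sumFin-cong {ℕ.zero} f≡g = refl
sumFin-cong {ℕ.suc p} f≡g = cong₂ _+_ (f≡g zero) (sumFin-cong (f≡g ∘ suc))

sumFin-zero : ∀ {p} {f : Fin p → ℚ} → (∀ k → f k ≡ 0ℚ) → sumFin f ≡ 0ℚ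
sumFin-zero {ℕ.zero} f≡0 = refl
sumFin-zero {ℕ.suc p} f≡0 rewrite f≡0 zero | sumFin-zero (f≡0 ∘ suc) = refl

sumFin-+ : ∀ {p} (f g : Fin p → ℚ) → sumFin (λ k → f k + g k) ≡ sumFin f + sumFin g
sumFin-+ {ℕ.zero} f g = refl
sumFin-+ {ℕ.suc p} f g = trans (cong (f zero + g zero +_) (sumFin-+ (f ∘ suc) (g ∘ suc)))
  (interchange (f zero) (g zero) (sumFin (f ∘ suc)) (sumFin (g ∘ suc)))
  where
  interchange : ∀ a b c d → (a + b) + (c + d) ≡ (a + c) + (b + d)
  interchange = solve 4 (λ a b c d → (a :+ b) :+ (c :+ d) := (a :+ c) :+ (b :+ d)) refl

sumFin-*ˡ : ∀ {p} (c : ℚ) (f : Fin p → ℚ) → sumFin (λ k → c * f k) ≡ c * sumFin f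
sumFin-*ˡ {ℕ.zero} c f = sym (ℚP.*-zeroʳ c)
sumFin-*ˡ {ℕ.suc p} c f = trans (cong (c * f zero +_) (sumFin-*ˡ c (f ∘ suc)))
  (sym (ℚP.*-distribˡ-+ c (f zero) (sumFin (f ∘ suc))))

sumFin-isInt : ∀ {p} {f : Fin p → ℚ} → (∀ k → IsInt (f k)) → IsInt (sumFin f)
sumFin-isInt {ℕ.zero} int = isInt-0
sumFin-isInt {ℕ.suc p} int = isInt-+ (int zero) (sumFin-isInt (int ∘ suc))

χ : ∀ {n} → Maybe (Fin n) → Vecℚ n
χ nothing  i = 0ℚ
χ (just j) i = if does (j ≟ i) then 1ℚ else 0ℚ

χ-isInt : ∀ {n} (a : Maybe (Fin n)) i → IsInt (χ a i)
χ-isInt nothing  i = isInt-0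
χ-isInt (just j) i with does (j ≟ i)
... | true  = isInt-1
... | false = isInt-0

χ-diag : ∀ {n} (j : Fin n) → χ (just j) j ≡ 1ℚ
χ-diag j with j ≟ j
... | yes _  = refl
... | no j≢j = contradiction refl j≢j

χ-offDiag : ∀ {n} {j i : Fin n} → j ≢ i → χ (just j) i ≡ 0ℚ
χ-offDiag {j = j} {i} j≢i with j ≟ i
... | yes j≡i = contradiction j≡i j≢i
... | no _    = refl

unsuc : ∀ {n} → Maybe (Fin (ℕ.suc n)) → Maybe (Fin n)
unsuc nothing        = nothing
unsuc (just zero)    = nothing
unsuc (just (suc j)) = just j

χ-suc : ∀ {n} (a : Maybe (Fin (ℕ.suc n))) i → χ a (suc i) ≡ χ (unsuc a) i
χ-suc nothing        i = refl
χ-suc (just zero)    i = refl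
χ-suc (just (suc j)) i = refl

χ-zero : ∀ {n} (a : Maybe (Fin (ℕ.suc n))) → a ≡ just zero ⊎ χ a zero ≡ 0ℚ
χ-zero nothing        = inj₂ refl
χ-zero (just zero)    = inj₁ refl
χ-zero (just (suc j)) = inj₂ refl

sumFin-χ : ∀ {p} (k : Fin p) (f : Fin p → ℚ) → sumFin (λ l → χ (just k) l * f l) ≡ f k
sumFin-χ zero f = begin
  1ℚ * f zero + sumFin (λ l → 0ℚ * f (suc l))  ≡⟨ cong (1ℚ * f zero +_) (sumFin-zero (ℚP.*-zeroˡ ∘ f ∘ suc)) ⟩
  1ℚ * f zero + 0ℚ                             ≡⟨ ℚP.+-identityʳ _ ⟩
  1ℚ * f zero                                  ≡⟨ ℚP.*-identityˡ _ ⟩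
  f zero                                       ∎
  where open ≡-Reasoning
sumFin-χ (suc k) f = begin
  0ℚ * f zero + sumFin (λ l → χ (just k) l * f (suc l))  ≡⟨ cong₂ _+_ (ℚP.*-zeroˡ (f zero)) (sumFin-χ k (f ∘ suc)) ⟩
  0ℚ + f (suc k)                                         ≡⟨ ℚP.+-identityˡ _ ⟩
  f (suc k)                                              ∎
  where open ≡-Reasoning

-- comb μ r is combᵛ μ (toℚᵛ ∘ r) by definition, so LinIndep r is LinIndepᵛ (toℚᵛ ∘ r).
combᵛ : ∀ {n p} → (Fin p → ℚ) → (Fin p → Vecℚ n) → Vecℚ n
combᵛ μ v i = sumFin (λ k → μ k * v k i)

LinIndepᵛ : ∀ {n p} → (Fin p → Vecℚ n) → Subset p → Set
LinIndepᵛ {p = p} v σ =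
  ∀ (λ' : Fin p → ℚ) → SupportedOn 0ℚ λ' σ → combᵛ λ' v ≈ᵛ 0ᵛ → ∀ k → λ' k ≡ 0ℚ

combᵛ-cong : ∀ {n p} {μ μ' : Fin p → ℚ} (v : Fin p → Vecℚ n) →
  (∀ k → μ k ≡ μ' k) → combᵛ μ v ≈ᵛ combᵛ μ' v
combᵛ-cong v μ≡μ' i = sumFin-cong (λ k → cong (_* v k i) (μ≡μ' k))

combᵛ-isInt : ∀ {n p} {μ : Fin p → ℚ} {v : Fin p → Vecℚ n} →
  (∀ k → IsInt (μ k)) → (∀ k i → IsInt (v k i)) → ∀ i → IsInt (combᵛ μ v i)
combᵛ-isInt μ-int v-int i = sumFin-isInt (λ k → isInt-* (μ-int k) (v-int k i))

combᵛ-update : ∀ {n p} (α : Fin p → ℚ) (t : ℚ) (k : Fin p) (v : Fin p → Vecℚ n) i →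
  combᵛ (λ l → α l + t * χ (just k) l) v i ≡ combᵛ α v i + t * v k i
combᵛ-update α t k v i = begin
  sumFin (λ l → (α l + t * χ (just k) l) * v l i)          ≡⟨ sumFin-cong (λ l → distrib (α l) t (χ (just k) l) (v l i)) ⟩
  sumFin (λ l → α l * v l i + t * δv l)                    ≡⟨ sumFin-+ (λ l → α l * v l i) (λ l → t * δv l) ⟩
  combᵛ α v i + sumFin (λ l → t * δv l)                    ≡⟨ cong (combᵛ α v i +_) (sumFin-*ˡ t δv) ⟩
  combᵛ α v i + t * sumFin (λ l → χ (just k) l * v l i)    ≡⟨ cong (λ x → combᵛ α v i + t * x) (sumFin-χ k (λ l → v l i)) ⟩
  combᵛ α v i + t * v k i                                  ∎
  where
  open ≡-Reasoning
  δv = λ l → χ (just k) l * v l i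
  distrib : ∀ a t x y → (a + t * x) * y ≡ a * y + t * (x * y)
  distrib = solve 4 (λ a t x y → (a :+ t :* x) :* y := a :* y :+ t :* (x :* y)) refl

combᵛ-shear : ∀ {n p} (λ' w : Fin p → ℚ) (v : Fin p → Vecℚ n) (u : Vecℚ n) i →
  combᵛ λ' v i ≡ combᵛ λ' (λ l j → v l j - w l * u j) i + sumFin (λ l → λ' l * w l) * u i
combᵛ-shear λ' w v u i = begin
  sumFin (λ l → λ' l * v l i)                ≡⟨ sumFin-cong (λ l → split (λ' l) (v l i) (w l) (u i)) ⟩
  sumFin (λ l → λ' l * v′ l i + u i * λw l)  ≡⟨ sumFin-+ (λ l → λ' l * v′ l i) (λ l → u i * λw l) ⟩
  combᵛ λ' v′ i + sumFin (λ l → u i * λw l)   ≡⟨ cong (combᵛ λ' v′ i +_) (sumFin-*ˡ (u i) λw) ⟩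
  combᵛ λ' v′ i + u i * sumFin λw             ≡⟨ cong (combᵛ λ' v′ i +_) (ℚP.*-comm (u i) (sumFin λw)) ⟩
  combᵛ λ' v′ i + sumFin λw * u i             ∎
  where
  open ≡-Reasoning
  v′ = λ l j → v l j - w l * u j
  λw = λ l → λ' l * w l
  split : ∀ a x s y → a * x ≡ a * (x - s * y) + y * (a * s)
  split = solve 4 (λ a x s y → a :* x := a :* (x :- s :* y) :+ y :* (a :* s)) refl

-- A column of a network matrix; nothing encodes a missing ±1 entry.
IsNetwork : ∀ {n} → Vecℚ n → Set
IsNetwork {n} w = ∃₂ λ (a b : Maybe (Fin n)) → w ≈ᵛ (λ i → χ a i - χ b i)

IsSign : ℚ → Set
IsSign s = s ≡ 1ℚ ⊎ s ≡ - 1ℚ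

sign-square : ∀ {s} → IsSign s → s * s ≡ 1ℚ
sign-square (inj₁ refl) = refl
sign-square (inj₂ refl) = refl

network-cong : ∀ {n} {w w' : Vecℚ n} → w ≈ᵛ w' → IsNetwork w → IsNetwork w'
network-cong w≈w' (a , b , w≈) = a , b , λ i → trans (sym (w≈w' i)) (w≈ i)

network-isInt : ∀ {n} {w : Vecℚ n} → IsNetwork w → ∀ i → IsInt (w i)
network-isInt (a , b , w≈) i = subst IsInt (sym (w≈ i)) (isInt-- (χ-isInt a i) (χ-isInt b i))

network-tail : ∀ {n} {w : Vecℚ (ℕ.suc n)} → IsNetwork w → IsNetwork (tail w)
network-tail (a , b , w≈) = unsuc a , unsuc b , λ i → trans (w≈ (suc i)) (cong₂ _-_ (χ-suc a i) (χ-suc b i))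

network-sign : ∀ {n s} → IsSign s → (a b : Maybe (Fin n)) → IsNetwork (λ i → s * (χ a i - χ b i))
network-sign (inj₁ refl) a b = a , b , λ i → ℚP.*-identityˡ _
network-sign (inj₂ refl) a b = b , a , λ i → -1*[x-y]≡y-x (χ a i) (χ b i)
  where
  -1*[x-y]≡y-x : ∀ x y → - 1ℚ * (x - y) ≡ y - x
  -1*[x-y]≡y-x = solve 2 (λ x y → :- con 1ℚ :* (x :- y) := y :- x) refl

network-head : ∀ {n} {w : Vecℚ (ℕ.suc n)} → IsNetwork w → head w ≢ 0ℚ →
  ∃₂ λ s x → IsSign s × head w ≡ s × tail w ≈ᵛ (λ i → - (s * χ x i))
network-head (a , b , w≈) w₀≢0 with χ-zero a | χ-zero b
... | inj₁ refl | inj₁ refl = contradiction (w≈ zero) w₀≢0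
... | inj₂ a₀≡0 | inj₂ b₀≡0 = contradiction (trans (w≈ zero) (cong₂ _-_ a₀≡0 b₀≡0)) w₀≢0
... | inj₁ refl | inj₂ b₀≡0 =
  1ℚ , unsuc b , inj₁ refl , trans (w≈ zero) (cong (λ x → 1ℚ - x) b₀≡0) ,
  λ i → trans (w≈ (suc i)) (trans (cong (λ x → 0ℚ - x) (χ-suc b i)) (0-x≡-[1*x] (χ (unsuc b) i)))
  where
  0-x≡-[1*x] : ∀ x → 0ℚ - x ≡ - (1ℚ * x)
  0-x≡-[1*x] = solve 1 (λ x → con 0ℚ :- x := :- (con 1ℚ :* x)) refl
... | inj₂ a₀≡0 | inj₁ refl =
  - 1ℚ , unsuc a , inj₂ refl , trans (w≈ zero) (cong (_- 1ℚ) a₀≡0) ,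
  λ i → trans (w≈ (suc i)) (trans (cong (_- 0ℚ) (χ-suc a i)) (x-0≡-[-1*x] (χ (unsuc a) i)))
  where
  x-0≡-[-1*x] : ∀ x → x - 0ℚ ≡ - (- 1ℚ * x)
  x-0≡-[-1*x] = solve 1 (λ x → x :- con 0ℚ := :- (:- con 1ℚ :* x)) refl

network-pivot : ∀ {n} {w u : Vecℚ (ℕ.suc n)} → IsNetwork w → IsNetwork u → head u ≢ 0ℚ →
  IsNetwork (λ i → tail w i - (head w * head u) * tail u i)
network-pivot {w = w} {u} w-net u-net u₀≢0 with head w ℚP.≟ 0ℚ
... | yes w₀≡0 = network-cong unchanged (network-tail w-net)
  where
  x≡x-[0*y]*z : ∀ x y z → x ≡ x - (0ℚ * y) * z
  x≡x-[0*y]*z = solve 3 (λ x y z → x := x :- (con 0ℚ :* y) :* z) refl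
  unchanged : tail w ≈ᵛ (λ i → tail w i - (head w * head u) * tail u i)
  unchanged i rewrite w₀≡0 = x≡x-[0*y]*z (tail w i) (head u) (tail u i)
... | no w₀≢0 with network-head w-net w₀≢0 | network-head u-net u₀≢0
...   | s , x , s± , w₀≡s , w′≈ | t , y , t± , u₀≡t , u′≈ =
  network-cong (λ i → sym (cleared i)) (network-sign s± y x)
  where
  open ≡-Reasoning
  expand : ∀ s t x y → - (s * x) - (s * t) * - (t * y) ≡ s * ((t * t) * y - x)
  expand = solve 4 (λ s t x y → :- (s :* x) :- (s :* t) :* :- (t :* y) := s :* ((t :* t) :* y :- x)) refl
  cleared : ∀ i → tail w i - (head w * head u) * tail u i ≡ s * (χ y i - χ x i)
  cleared i = begin
    tail w i - (head w * head u) * tail u i         ≡⟨ cong₂ (λ a b → a - b * tail u i) (w′≈ i) (cong₂ _*_ w₀≡s u₀≡t) ⟩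
    - (s * χ x i) - (s * t) * tail u i              ≡⟨ cong (λ b → - (s * χ x i) - (s * t) * b) (u′≈ i) ⟩
    - (s * χ x i) - (s * t) * - (t * χ y i)         ≡⟨ expand s t (χ x i) (χ y i) ⟩
    s * ((t * t) * χ y i - χ x i)                   ≡⟨ cong (λ q → s * (q * χ y i - χ x i)) (sign-square t±) ⟩
    s * (1ℚ * χ y i - χ x i)                        ≡⟨ cong (λ q → s * (q - χ x i)) (ℚP.*-identityˡ (χ y i)) ⟩
    s * (χ y i - χ x i)                             ∎

x∉p∖x : ∀ {n} (p : Subset n) x → x ∉ p ∖ x
x∉p∖x (_ ∷ᵛ p) zero ()
x∉p∖x (_ ∷ᵛ p) (suc x) (there x∈p∖x) = x∉p∖x p x x∈p∖x

IntegralCoordinates : ∀ {n p} → (Fin p → Vecℚ n) → Subset p → Set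
IntegralCoordinates {p = p} v σ = ∀ (μ : Fin p → ℚ) → SupportedOn 0ℚ μ σ →
  (∀ i → IsInt (combᵛ μ v i)) → ∀ k → k ∈ σ → IsInt (μ k)

linIndep-tail : ∀ {n p} {v : Fin p → Vecℚ (ℕ.suc n)} {σ : Subset p} →
  (∀ k → k ∈ σ → head (v k) ≡ 0ℚ) → LinIndepᵛ v σ → LinIndepᵛ (tail ∘ v) σ
linIndep-tail {v = v} {σ} row₀≡0 indep λ' supp comb≡0 = indep λ' supp comb′≡0
  where
  term≡0 : ∀ k → λ' k * head (v k) ≡ 0ℚ
  term≡0 k with k ∈? σ
  ... | yes k∈σ = trans (cong (λ' k *_) (row₀≡0 k k∈σ)) (ℚP.*-zeroʳ (λ' k))
  ... | no k∉σ  = trans (cong (_* head (v k)) (supp k k∉σ)) (ℚP.*-zeroˡ (head (v k)))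
  comb′≡0 : combᵛ λ' v ≈ᵛ 0ᵛ
  comb′≡0 zero    = sumFin-zero term≡0
  comb′≡0 (suc i) = comb≡0 i

module Pivot {n p} (v : Fin p → Vecℚ (ℕ.suc n)) (v-net : ∀ k → IsNetwork (v k))
             (k₀ : Fin p) (c≢0 : head (v k₀) ≢ 0ℚ) where

  open ≡-Reasoning

  c : ℚ
  c = head (v k₀)

  c*c≡1 : c * c ≡ 1ℚ
  c*c≡1 with network-head (v-net k₀) c≢0
  ... | _ , _ , c± , c≡s , _ = trans (cong₂ _*_ c≡s c≡s) (sign-square c±)

  cleared : Fin p → Vecℚ n
  cleared l i = tail (v l) i - (head (v l) * c) * tail (v k₀) i

  cleared-network : ∀ l → IsNetwork (cleared l)
  cleared-network l = network-pivot (v-net l) (v-net k₀) c≢0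

  cleared-pivot : cleared k₀ ≈ᵛ 0ᵛ
  cleared-pivot i = begin
    u - (c * c) * u  ≡⟨ cong (λ q → u - q * u) c*c≡1 ⟩
    u - 1ℚ * u       ≡⟨ cong (λ q → u - q) (ℚP.*-identityˡ u) ⟩
    u - u            ≡⟨ ℚP.+-inverseʳ u ⟩
    0ℚ               ∎
    where
    u = tail (v k₀) i

  comb-suc : ∀ λ' i →
    combᵛ λ' v (suc i) ≡ combᵛ λ' cleared i + (combᵛ λ' v zero * c) * tail (v k₀) i
  comb-suc λ' i = begin
    combᵛ λ' v (suc i)                                               ≡⟨ combᵛ-shear λ' w (tail ∘ v) (tail (v k₀)) i ⟩
    combᵛ λ' cleared i + sumFin (λ l → λ' l * w l) * tail (v k₀) i  ≡⟨ cong (λ x → combᵛ λ' cleared i + x * tail (v k₀) i) weights ⟩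
    combᵛ λ' cleared i + (combᵛ λ' v zero * c) * tail (v k₀) i      ∎
    where
    w = λ l → head (v l) * c
    reassoc : ∀ a x c → a * (x * c) ≡ c * (a * x)
    reassoc = solve 3 (λ a x c → a :* (x :* c) := c :* (a :* x)) refl
    weights : sumFin (λ l → λ' l * w l) ≡ combᵛ λ' v zero * c
    weights = begin
      sumFin (λ l → λ' l * w l)              ≡⟨ sumFin-cong (λ l → reassoc (λ' l) (head (v l)) c) ⟩
      sumFin (λ l → c * (λ' l * head (v l)))  ≡⟨ sumFin-*ˡ c (λ l → λ' l * head (v l)) ⟩
      c * combᵛ λ' v zero                    ≡⟨ ℚP.*-comm c (combᵛ λ' v zero) ⟩
      combᵛ λ' v zero * c                    ∎

  cleared-linIndep : ∀ {σ} → k₀ ∈ σ → LinIndepᵛ v σ → LinIndepᵛ cleared (σ ∖ k₀)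
  cleared-linIndep {σ} k₀∈σ indep λ' supp comb≡0 l = coefficient (l ≟ k₀)
    where
    -- Adding back a multiple of the pivot turns the relation among the cleared
    -- vectors into a relation among the original ones.
    a = combᵛ λ' v zero
    λ* : Fin p → ℚ
    λ* l = λ' l + - (a * c) * χ (just k₀) l

    λ*≡λ' : ∀ {l} → l ≢ k₀ → λ* l ≡ λ' l
    λ*≡λ' {l} l≢k₀ = begin
      λ' l + - (a * c) * χ (just k₀) l  ≡⟨ cong (λ q → λ' l + - (a * c) * q) (χ-offDiag (l≢k₀ ∘ sym)) ⟩
      λ' l + - (a * c) * 0ℚ             ≡⟨ cong (λ' l +_) (ℚP.*-zeroʳ (- (a * c))) ⟩
      λ' l + 0ℚ                         ≡⟨ ℚP.+-identityʳ (λ' l) ⟩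
      λ' l                              ∎

    λ*-supp : SupportedOn 0ℚ λ* σ
    λ*-supp l l∉σ = trans (λ*≡λ' λ { refl → l∉σ k₀∈σ }) (supp l (l∉σ ∘ p─q⊆p σ _))

    λ*-comb : combᵛ λ* v ≈ᵛ 0ᵛ
    λ*-comb zero = begin
      combᵛ λ* v zero            ≡⟨ combᵛ-update λ' (- (a * c)) k₀ v zero ⟩
      a + - (a * c) * c          ≡⟨ expand a c ⟩
      a - a * (c * c)            ≡⟨ cong (λ q → a - a * q) c*c≡1 ⟩
      a - a * 1ℚ                 ≡⟨ cong (λ q → a - q) (ℚP.*-identityʳ a) ⟩
      a - a                      ≡⟨ ℚP.+-inverseʳ a ⟩
      0ℚ                         ∎
      where
      expand : ∀ a c → a + - (a * c) * c ≡ a - a * (c * c)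
      expand = solve 2 (λ a c → a :+ :- (a :* c) :* c := a :- a :* (c :* c)) refl
    λ*-comb (suc i) = begin
      combᵛ λ* v (suc i)                                     ≡⟨ combᵛ-update λ' (- (a * c)) k₀ v (suc i) ⟩
      combᵛ λ' v (suc i) + - (a * c) * u                     ≡⟨ cong (_+ - (a * c) * u) (comb-suc λ' i) ⟩
      (combᵛ λ' cleared i + (a * c) * u) + - (a * c) * u     ≡⟨ cong (λ x → (x + (a * c) * u) + - (a * c) * u) (comb≡0 i) ⟩
      (0ℚ + (a * c) * u) + - (a * c) * u                     ≡⟨ cancel (a * c) u ⟩
      0ℚ                                                     ∎
      where
      u = tail (v k₀) i
      cancel : ∀ x u → (0ℚ + x * u) + - x * u ≡ 0ℚ
      cancel = solve 2 (λ x u → (con 0ℚ :+ x :* u) :+ :- x :* u := con 0ℚ) refl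

    coefficient : Dec (l ≡ k₀) → λ' l ≡ 0ℚ
    coefficient (yes refl) = supp k₀ (x∉p∖x σ k₀)
    coefficient (no l≢k₀)  = trans (sym (λ*≡λ' l≢k₀)) (indep λ* λ*-supp λ*-comb l)

  withoutPivot : (Fin p → ℚ) → Fin p → ℚ
  withoutPivot μ l = μ l - μ k₀ * χ (just k₀) l

  withoutPivot-offPivot : ∀ μ {l} → l ≢ k₀ → withoutPivot μ l ≡ μ l
  withoutPivot-offPivot μ {l} l≢k₀ = begin
    μ l - μ k₀ * χ (just k₀) l  ≡⟨ cong (λ q → μ l - μ k₀ * q) (χ-offDiag (l≢k₀ ∘ sym)) ⟩
    μ l - μ k₀ * 0ℚ             ≡⟨ cong (λ q → μ l - q) (ℚP.*-zeroʳ (μ k₀)) ⟩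
    μ l - 0ℚ                    ≡⟨ ℚP.+-identityʳ (μ l) ⟩
    μ l                         ∎

  withoutPivot-supp : ∀ {σ} μ → SupportedOn 0ℚ μ σ → SupportedOn 0ℚ (withoutPivot μ) (σ ∖ k₀)
  withoutPivot-supp {σ} μ supp l l∉σ∖k₀ with l ≟ k₀
  ... | yes refl = begin
    μ k₀ - μ k₀ * χ (just k₀) k₀  ≡⟨ cong (λ q → μ k₀ - μ k₀ * q) (χ-diag k₀) ⟩
    μ k₀ - μ k₀ * 1ℚ              ≡⟨ cong (λ q → μ k₀ - q) (ℚP.*-identityʳ (μ k₀)) ⟩
    μ k₀ - μ k₀                   ≡⟨ ℚP.+-inverseʳ (μ k₀) ⟩
    0ℚ                            ∎
  ... | no l≢k₀ =
    trans (withoutPivot-offPivot μ l≢k₀) (supp l (λ l∈σ → l∉σ∖k₀ (x∈p∧x≢y⇒x∈p-y l∈σ l≢k₀)))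

  comb-withoutPivot : ∀ μ {m} (w : Fin p → Vecℚ m) i →
    combᵛ μ w i ≡ combᵛ (withoutPivot μ) w i + μ k₀ * w k₀ i
  comb-withoutPivot μ w i =
    trans (combᵛ-cong w (λ l → x≡[x-y]+y (μ l) (μ k₀ * χ (just k₀) l)) i)
          (combᵛ-update (withoutPivot μ) (μ k₀) k₀ w i)
    where
    x≡[x-y]+y : ∀ x y → x ≡ (x - y) + y
    x≡[x-y]+y = solve 2 (λ x y → x := (x :- y) :+ y) refl

  comb-cleared : ∀ μ i →
    combᵛ (withoutPivot μ) cleared i ≡ combᵛ μ v (suc i) - (combᵛ μ v zero * c) * tail (v k₀) i
  comb-cleared μ i = begin
    combᵛ μ′ cleared i                        ≡⟨ ℚP.+-identityʳ _ ⟨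
    combᵛ μ′ cleared i + 0ℚ                   ≡⟨ cong (combᵛ μ′ cleared i +_) (ℚP.*-zeroʳ (μ k₀)) ⟨
    combᵛ μ′ cleared i + μ k₀ * 0ℚ            ≡⟨ cong (λ q → combᵛ μ′ cleared i + μ k₀ * q) (cleared-pivot i) ⟨
    combᵛ μ′ cleared i + μ k₀ * cleared k₀ i  ≡⟨ comb-withoutPivot μ cleared i ⟨
    combᵛ μ cleared i                         ≡⟨ x≡[x+y]-y (combᵛ μ cleared i) d ⟩
    (combᵛ μ cleared i + d) - d               ≡⟨ cong (_- d) (comb-suc μ i) ⟨
    combᵛ μ v (suc i) - d                     ∎
    where
    μ′ = withoutPivot μ
    d = (combᵛ μ v zero * c) * tail (v k₀) i
    x≡[x+y]-y : ∀ x y → x ≡ (x + y) - y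
    x≡[x+y]-y = solve 2 (λ x y → x := (x :+ y) :- y) refl

  pivot-coefficient : ∀ μ → μ k₀ ≡ (combᵛ μ v zero - combᵛ (withoutPivot μ) v zero) * c
  pivot-coefficient μ = begin
    μ k₀                                ≡⟨ ℚP.*-identityʳ (μ k₀) ⟨
    μ k₀ * 1ℚ                           ≡⟨ cong (μ k₀ *_) c*c≡1 ⟨
    μ k₀ * (c * c)                      ≡⟨ recombine a (μ k₀) c ⟩
    ((a + μ k₀ * c) - a) * c            ≡⟨ cong (λ x → (x - a) * c) (comb-withoutPivot μ v zero) ⟨
    (combᵛ μ v zero - a) * c            ∎
    where
    a = combᵛ (withoutPivot μ) v zero
    recombine : ∀ a m c → m * (c * c) ≡ ((a + m * c) - a) * c
    recombine = solve 3 (λ a m c → m :* (c :* c) := ((a :+ m :* c) :- a) :* c) refl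

  cleared-integral : ∀ {σ} → IntegralCoordinates cleared (σ ∖ k₀) → IntegralCoordinates v σ
  cleared-integral {σ} ih μ supp z-int k k∈σ = coordinate (k ≟ k₀)
    where
    μ′ = withoutPivot μ
    μ′-supp = withoutPivot-supp μ supp

    v-int : ∀ l i → IsInt (v l i)
    v-int l = network-isInt (v-net l)

    μ′-comb-int : ∀ i → IsInt (combᵛ μ′ cleared i)
    μ′-comb-int i = subst IsInt (sym (comb-cleared μ i))
      (isInt-- (z-int (suc i)) (isInt-* (isInt-* (z-int zero) (v-int k₀ zero)) (v-int k₀ (suc i))))

    μ′-int : ∀ l → IsInt (μ′ l)
    μ′-int l = let ν , _ , μ′≡ν = ℤ-coefficients μ′-supp (ih μ′ μ′-supp μ′-comb-int) in ν l , μ′≡ν l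

    coordinate : Dec (k ≡ k₀) → IsInt (μ k)
    coordinate (yes refl) = subst IsInt (sym (pivot-coefficient μ))
      (isInt-* (isInt-- (z-int zero) (combᵛ-isInt μ′-int v-int zero)) (v-int k₀ zero))
    coordinate (no k≢k₀)  = subst IsInt (withoutPivot-offPivot μ k≢k₀) (μ′-int k)

network-integralCoordinates : ∀ n {p} (v : Fin p → Vecℚ n) → (∀ k → IsNetwork (v k)) →
  ∀ σ → LinIndepᵛ v σ → IntegralCoordinates v σ
network-integralCoordinates ℕ.zero v _ σ indep μ supp _ k _ =
  subst IsInt (sym (indep μ supp (λ ()) k)) isInt-0
network-integralCoordinates (ℕ.suc n) v v-net σ indep
  with any? (λ k → (k ∈? σ) ×-dec ¬? (head (v k) ℚP.≟ 0ℚ))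
... | yes (k₀ , k₀∈σ , c≢0) =
  cleared-integral (network-integralCoordinates n cleared cleared-network (σ ∖ k₀) (cleared-linIndep k₀∈σ indep))
  where open Pivot v v-net k₀ c≢0
... | no noPivot = λ μ supp z-int →
  network-integralCoordinates n (tail ∘ v) (network-tail ∘ v-net) σ (linIndep-tail row₀≡0 indep) μ supp (z-int ∘ suc)
  where
  row₀≡0 : ∀ k → k ∈ σ → head (v k) ≡ 0ℚ
  row₀≡0 k k∈σ = decidable-stable (head (v k) ℚP.≟ 0ℚ) (λ c≢0 → noPivot (k , k∈σ , c≢0))

toℚ-e : ∀ {n} (i l : Fin n) → toℚ (e i l) ≡ χ (just i) l
toℚ-e i l with does (i ≟ l)
... | true  = refl
... | false = refl

elementary-network : ∀ {n} (A : Subset n) (w : Vecℤ n) → InElementarySet A w → IsNetwork (toℚᵛ w)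
elementary-network A w (inj₁ (i , j , _ , w≈)) = just i , just j , λ l →
  trans (cong toℚ (w≈ l)) (trans (toℚ-- (e i l) (e j l)) (cong₂ _-_ (toℚ-e i l) (toℚ-e j l)))
elementary-network A w (inj₂ (inj₁ (i , w≈))) = just i , nothing , λ l →
  trans (cong toℚ (w≈ l)) (trans (toℚ-e i l) (sym (ℚP.+-identityʳ _)))
elementary-network A w (inj₂ (inj₂ (j , _ , w≈))) = nothing , just j , λ l →
  trans (cong toℚ (w≈ l)) (trans (toℚ-neg (e j l)) (trans (cong -_ (toℚ-e j l)) (sym (ℚP.+-identityˡ _))))

independent-elementary-unimodular : ∀ {n p} (A : Subset n) (r : Fin p → Vecℤ n) (σ : Subset p) →
  (∀ k → InElementarySet A (r k)) → LinIndep r σ → IsUnimodular r σ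
independent-elementary-unimodular {n} A r σ r∈R indep = indep , lattice-basis
  where
  lattice-basis : ∀ z μ → SupportedOn 0ℚ μ σ → toℚᵛ z ≈ᵛ comb μ r →
    Σ (Fin _ → ℤ) λ ν → SupportedOn (ℤ.+ 0) ν σ × (toℚᵛ z ≈ᵛ comb (λ k → toℚ (ν k)) r)
  lattice-basis z μ supp z≈ =
    let ν , ν-supp , μ≡ν = ℤ-coefficients supp μ-int
    in  ν , ν-supp , λ i → trans (z≈ i) (combᵛ-cong (toℚᵛ ∘ r) μ≡ν i)
    where
    μ-int = network-integralCoordinates n (toℚᵛ ∘ r) (λ k → elementary-network A (r k) (r∈R k))
              σ indep μ supp (λ i → z i , sym (z≈ i))

lemma2p4 : (n p : ℕ) (A : Subset n) (r : Fin p → Vecℤ n) →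
    (∀ k → InElementarySet A (r k)) →
    (∀ k l → r k ≈ℤ r l → k ≡ l) →
    (∀ k → IsExtremalRay r k) →
    (m : ℕ) (σ : Fin m → Subset p) → IsTriangulation r σ →
    ∀ t → IsUnimodular r (σ t)
lemma2p4 n p A r r∈R _ _ m σ T t =
  independent-elementary-unimodular A r (σ t) r∈R (IsTriangulation.simplicial T t)
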